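{- Let $G=(V,E)$ be a simple graph with $V=\{v_1,\dots,v_n\}$ and let $A=(a_{i,j})$ be any $n\times n$ complex matrix such that $a_{i,j}=0$ whenever $v_iv_j\notin E$. For any proper subset $S$ of $V$ such that $G-S$ is bipartite, $r(A)\le 2m(G)+|S|$.
   Context: $r(A)$ is the rank of $A$; $m(G)$ is the matching number of $G$; $G-S$ is the subgraph induced by $V\setminus S$. Since $G$ is simple (no loops), the hypothesis forces $a_{i,i}=0$. -}

module Defs where

open import Level using (Level; _⊔_; suc)
open import Algebra.Bundles using (CommutativeRing)
open import Data.Nat as ℕ using (ℕ)
open import Data.Fin using (Fin)
open import Data.Fin.Subset using (Subset; _∈_; _∉_)
open import Data.Bool using (Bool)
open import Data.List using (List; []; _∷_; length; foldr; concatMap)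
open import Data.List.Relation.Unary.Unique.Propositional using (Unique)
open import Data.List.Relation.Unary.All using (All)
open import Data.Product using (Σ; ∃; _×_; _,_; proj₁; proj₂)
open import Relation.Nullary using (¬_)
open import Relation.Binary.PropositionalEquality using (_≡_; _≢_)

record Field (c ℓ : Level) : Set (Level.suc (c ⊔ ℓ)) where
  field
    commutativeRing : CommutativeRing c ℓ
  open CommutativeRing commutativeRing public
  field
    0≉1     : ¬ (0# ≈ 1#)
    inverse : ∀ x → ¬ (x ≈ 0#) → ∃ λ y → (x * y) ≈ 1#

-- Simple graphs on the vertex set Fin n (vertex v_i ↔ i).

record SimpleGraph (n : ℕ) : Set₁ where
  field
    Adj     : Fin n → Fin n → Set
    symm    : ∀ {i j} → Adj i j → Adj j i
    irrefl  : ∀ {i} → ¬ Adj i i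

open SimpleGraph public

endpoints : ∀ {n} → List (Fin n × Fin n) → List (Fin n)
endpoints = concatMap (λ e → proj₁ e ∷ proj₂ e ∷ [])

IsMatching : ∀ {n} → SimpleGraph n → List (Fin n × Fin n) → Set
IsMatching G M = All (λ e → Adj G (proj₁ e) (proj₂ e)) M × Unique (endpoints M)

IsMatchingNumber : ∀ {n} → SimpleGraph n → ℕ → Set
IsMatchingNumber {n} G m =
  (∃ λ M → IsMatching G M × length M ≡ m) ×
  (∀ M → IsMatching G M → length M ℕ.≤ m)

BipartiteMinus : ∀ {n} → SimpleGraph n → Subset n → Set
BipartiteMinus {n} G S =
  Σ (Fin n → Bool) λ col →
    ∀ i j → i ∉ S → j ∉ S → Adj G i j → col i ≢ col j

ProperSubset : ∀ {n} → Subset n → Set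
ProperSubset {n} S = ∃ λ (v : Fin n) → v ∉ S

module _ {c ℓ} (F : Field c ℓ) where
  open Field F

  Matrix : ℕ → Set c
  Matrix n = Fin n → Fin n → Carrier

  sumOver : ∀ {n} → List (Fin n) → (Fin n → Carrier) → Carrier
  sumOver R f = foldr (λ i acc → f i + acc) 0# R

  IndependentRows : ∀ {n} → Matrix n → List (Fin n) → Set (c ⊔ ℓ)
  IndependentRows {n} A R =
    Unique R ×
    (∀ (coef : Fin n → Carrier) →
       (∀ k → sumOver R (λ i → coef i * A i k) ≈ 0#) →
       All (λ i → coef i ≈ 0#) R)

  IsRank : ∀ {n} → Matrix n → ℕ → Set (c ⊔ ℓ)
  IsRank A r =
    (∃ λ R → IndependentRows A R × length R ≡ r) ×
    (∀ R → IndependentRows A R → length R ℕ.≤ r)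

{-# OPTIONS --safe #-}
module Submission where

-- If r rows of A are linearly independent, an exchange argument picks for
-- each of them a distinct column with a nonzero entry: r non-attacking rooks
-- on the support of A, i.e. r edges of G no two of which share a first or a
-- second endpoint.  At most |S| of these edges start in S.  The others start
-- outside S, and those whose first endpoint has a given colour form a
-- matching: a second endpoint outside S of that colour would give an edge of
-- G - S inside one colour class.  Hence r ≤ |S| + 2 m(G).
--
-- Equality in a field is not decidable, so the linear algebra is done in the
-- double-negation monad; the final inequality of natural numbers is stable.

open import Defs
open import Level using (Level; 0ℓ; _⊔_)
open import Data.Nat as Nat using (ℕ; zero; suc; _≤_; _≤?_; z≤n; s≤s)
import Data.Nat.Properties as ℕₚ
open import Data.Nat.Properties using (≤-trans; ≤-reflexive; +-mono-≤; +-monoʳ-≤; n≤1+n; +-suc; module ≤-Reasoning)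
open import Data.Fin using (Fin; zero; suc; punchIn)
open import Data.Fin.Properties using (_≟_; ∀-cons; punchInᵢ≢i)
open import Data.Fin.Subset as Subset using (Subset; _∉_; ∣_∣)
open import Data.Fin.Subset.Properties using (_∈?_; x∈p∧x≢y⇒x∈p-y; x∈p⇒∣p-x∣<∣p∣)
open import Data.Bool using (Bool; false; true)
open import Data.Bool.Properties using (¬-not) renaming (_≟_ to _≟ᵇ_)
open import Data.List using (List; []; _∷_; length; lookup; filter; tabulate)
open import Data.List.Properties using (length-map; length-tabulate)
open import Data.List.Membership.Propositional.Properties using (∈-lookup)
open import Data.List.Relation.Unary.All as All using (All; []; _∷_)
open import Data.List.Relation.Unary.All.Properties as All using (all-filter)
open import Data.List.Relation.Unary.AllPairs as AllPairs using (AllPairs; []; _∷_)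
open import Data.List.Relation.Unary.AllPairs.Properties as AllPairs using ()
open import Data.List.Relation.Unary.Unique.Propositional using (Unique)
open import Data.Vec.Functional as Vector using (Vector; head; tail)
open import Data.Product using (Σ-syntax; _×_; _,_; proj₁; proj₂)
open import Data.Unit using (tt)
open import Function using (_∘_; id)
open import Function.Definitions using (Injective)
open import Relation.Nullary using (¬_; Dec; yes; no; ¬?; contradiction; negated-stable; ¬¬-map; ¬¬-excluded-middle)
open import Relation.Nullary.Decidable using (decidable-stable)
open import Relation.Unary using (Pred; U; Decidable)
open import Relation.Binary.PropositionalEquality as ≡ using (_≡_; _≢_)

private
  variable
    a b p q : Level
    A : Set a
    B : Set b

_>>=_ : ¬ ¬ A → (A → ¬ ¬ B) → ¬ ¬ B
m >>= f = negated-stable (¬¬-map f m)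

pure : A → ¬ ¬ A
pure = contradiction

¬¬-pull-Fin : ∀ {m} {Q : Fin m → Set a} → (∀ i → ¬ ¬ Q i) → ¬ ¬ (∀ i → Q i)
¬¬-pull-Fin {m = zero}  _ = pure λ ()
¬¬-pull-Fin {m = suc m} h = do
  q₀ ← h zero
  qs ← ¬¬-pull-Fin (h ∘ suc)
  pure (∀-cons q₀ qs)

lookup-injective : {xs : List A} → Unique xs → Injective _≡_ _≡_ (lookup xs)
lookup-injective (_   ∷ _) {zero}  {zero}  _  = ≡.refl
lookup-injective (x∉ ∷ _) {zero}  {suc j} eq = contradiction eq (All.lookup x∉ (∈-lookup j))
lookup-injective (x∉ ∷ _) {suc i} {zero}  eq = contradiction (≡.sym eq) (All.lookup x∉ (∈-lookup i))
lookup-injective (_   ∷ u) {suc i} {suc j} eq = ≡.cong suc (lookup-injective u eq)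

injective-∷ : ∀ {m n} {x : Fin n} {σ : Fin m → Fin n} →
  (∀ j → σ j ≢ x) → Injective _≡_ _≡_ σ → Injective _≡_ _≡_ (x Vector.∷ σ)
injective-∷ σ≢x σ-inj {zero}  {zero}  _  = ≡.refl
injective-∷ σ≢x σ-inj {zero}  {suc j} eq = contradiction (≡.sym eq) (σ≢x j)
injective-∷ σ≢x σ-inj {suc i} {zero}  eq = contradiction eq (σ≢x i)
injective-∷ σ≢x σ-inj {suc i} {suc j} eq = ≡.cong suc (σ-inj eq)

module LinearAlgebra {c ℓ} (F : Field c ℓ) where

  open Field F hiding (zero)
  open import Algebra.Properties.Semiring.Sum semiring
    using (sum; sum-cong-≋; sum-replicate-zero; sum-remove; ∑-comm; *-distribˡ-sum; *-distribʳ-sum)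
  open import Algebra.Properties.Ring ring using (-1*x≈-x)
  open import Relation.Binary.Reasoning.Setoid setoid

  _·_ : ∀ {m n} → Vector Carrier m → (Fin m → Vector Carrier n) → Vector Carrier n
  (cs · Ws) k = sum (λ j → cs j * Ws j k)

  ·-zeroˡ : ∀ {m n} (Ws : Fin m → Vector Carrier n) k → ((λ _ → 0#) · Ws) k ≈ 0#
  ·-zeroˡ {m} Ws k = trans (sum-cong-≋ {m} (λ j → zeroˡ (Ws j k))) (sum-replicate-zero m)

  ·-scaleˡ : ∀ {m n} t (cs : Vector Carrier m) (Ws : Fin m → Vector Carrier n) k →
    ((λ j → t * cs j) · Ws) k ≈ t * (cs · Ws) k
  ·-scaleˡ t cs Ws k =
    trans (sum-cong-≋ (λ j → *-assoc t (cs j) (Ws j k))) (sym (*-distribˡ-sum t (λ j → cs j * Ws j k)))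

  ·-sumˡ : ∀ {p m n} (ds : Fin p → Vector Carrier m) (Ws : Fin m → Vector Carrier n) k →
    ((λ j → sum (λ x → ds x j)) · Ws) k ≈ sum (λ x → (ds x · Ws) k)
  ·-sumˡ ds Ws k = begin
    sum (λ j → sum (λ x → ds x j) * Ws j k)   ≈⟨ sum-cong-≋ (λ j → *-distribʳ-sum (Ws j k) (λ x → ds x j)) ⟩
    sum (λ j → sum (λ x → ds x j * Ws j k))   ≈⟨ ∑-comm (λ j x → ds x j * Ws j k) ⟩
    sum (λ x → (ds x · Ws) k)                 ∎

  sum-δ : ∀ {m} (g : Vector Carrier m) k → (∀ x → x ≢ k → g x ≈ 0#) → sum g ≈ g k
  sum-δ {suc m} g k g≈0 = begin
    sum g                                 ≈⟨ sum-remove {i = k} g ⟩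
    g k + sum (λ j → g (punchIn k j))     ≈⟨ +-congˡ (sum-cong-≋ {m} (λ j → g≈0 (punchIn k j) (punchInᵢ≢i k j))) ⟩
    g k + sum {m} (λ _ → 0#)              ≈⟨ +-congˡ (sum-replicate-zero m) ⟩
    g k + 0#                              ≈⟨ +-identityʳ (g k) ⟩
    g k                                   ∎

  -1≉0 : - 1# ≉ 0#
  -1≉0 -1≈0 = 0≉1 (begin
    0#        ≈⟨ sym (-‿inverseʳ 1#) ⟩
    1# + - 1# ≈⟨ +-congˡ -1≈0 ⟩
    1# + 0#   ≈⟨ +-identityʳ 1# ⟩
    1#        ∎)

  -- Double-negated because equality in F is undecidable; this is what the
  -- exchange argument below delivers constructively.
  IndependentOn : ∀ {n} → Pred (Fin n) 0ℓ → ∀ {m} → (Fin m → Vector Carrier n) → Set (c ⊔ ℓ)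
  IndependentOn P Ws = ∀ cs → (∀ {k} → P k → (cs · Ws) k ≈ 0#) → ∀ j → ¬ ¬ (cs j ≈ 0#)

  _∖_ : ∀ {n} → Pred (Fin n) 0ℓ → Fin n → Pred (Fin n) 0ℓ
  (P ∖ x) k = P k × k ≢ x

  independentOn-tail : ∀ {m n} {P : Pred (Fin n) 0ℓ} {Ws : Fin (suc m) → Vector Carrier n} →
    IndependentOn P Ws → IndependentOn P (tail Ws)
  independentOn-tail {P = P} {Ws} ind cs rel j = ind (0# Vector.∷ cs) rel′ (suc j)
    where
    rel′ : ∀ {k} → P k → ((0# Vector.∷ cs) · Ws) k ≈ 0#
    rel′ {k} pk = trans (+-congʳ (zeroˡ (Ws zero k))) (trans (+-identityˡ _) (rel pk))

  CoordinateSpan : ∀ {m n} → Pred (Fin n) 0ℓ → (Fin m → Vector Carrier n) → Vector Carrier n → Fin n → Set (c ⊔ ℓ)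
  CoordinateSpan {m} P W v x =
    Σ[ ds ∈ Vector Carrier m ] (∀ {k} → P k → k ≢ x → (ds · W) k ≈ 0#) × (P x → (ds · W) x ≈ v x)

  coordinateSpan-zero : ∀ {m n} {P : Pred (Fin n) 0ℓ} {W : Fin m → Vector Carrier n} {v x} →
    (P x → v x ≈ 0#) → CoordinateSpan P W v x
  coordinateSpan-zero {W = W} {x = x} vx≈0 =
    (λ _ → 0#) , (λ {k} _ _ → ·-zeroˡ W k) , λ px → trans (·-zeroˡ W x) (sym (vx≈0 px))

  SpansOn : ∀ {m n} → Pred (Fin n) 0ℓ → (Fin m → Vector Carrier n) → Vector Carrier n → Set (c ⊔ ℓ)
  SpansOn {m} P W v = Σ[ ds ∈ Vector Carrier m ] (∀ {k} → P k → (ds · W) k ≈ v k)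

  span-from-coordinates : ∀ {m n} {P : Pred (Fin n) 0ℓ} {W : Fin m → Vector Carrier n} {v} →
    (∀ x → CoordinateSpan P W v x) → SpansOn P W v
  span-from-coordinates {P = P} {W} {v} spans = ds , ds·W≈v
    where
    ds : Vector Carrier _
    ds j = sum (λ x → proj₁ (spans x) j)

    ds·W≈v : ∀ {k} → P k → (ds · W) k ≈ v k
    ds·W≈v {k} pk = begin
      (ds · W) k                            ≈⟨ ·-sumˡ (proj₁ ∘ spans) W k ⟩
      sum (λ x → (proj₁ (spans x) · W) k)   ≈⟨ sum-δ _ k (λ x x≢k → proj₁ (proj₂ (spans x)) pk (x≢k ∘ ≡.sym)) ⟩
      (proj₁ (spans k) · W) k               ≈⟨ proj₂ (proj₂ (spans k)) pk ⟩
      v k                                   ∎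

  head-not-spanned : ∀ {m n} {P : Pred (Fin n) 0ℓ} {Ws : Fin (suc m) → Vector Carrier n} →
    IndependentOn P Ws → ¬ SpansOn P (tail Ws) (head Ws)
  head-not-spanned {P = P} {Ws} ind (ds , span) = ind (- 1# Vector.∷ ds) rel zero -1≉0
    where
    rel : ∀ {k} → P k → ((- 1# Vector.∷ ds) · Ws) k ≈ 0#
    rel {k} pk = begin
      - 1# * Ws zero k + (ds · tail Ws) k   ≈⟨ +-cong (-1*x≈-x _) (span pk) ⟩
      - Ws zero k + Ws zero k               ≈⟨ -‿inverseˡ _ ⟩
      0#                                    ∎

  -- If the combination cs · W vanishes on P ∖ x but not at x, rescaling it
  -- yields a coordinate span of any v at x.
  independentOn-∖ : ∀ {m n} {P : Pred (Fin n) 0ℓ} {W : Fin m → Vector Carrier n} {v x} →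
    IndependentOn P W → ¬ CoordinateSpan P W v x → IndependentOn (P ∖ x) W
  independentOn-∖ {P = P} {W} {v} {x} ind ¬span cs rel j = do
    μ≈0? ← ¬¬-excluded-middle
    case μ≈0?
    where
    μ = (cs · W) x

    relOnP : μ ≈ 0# → ∀ {k} → P k → (cs · W) k ≈ 0#
    relOnP μ≈0 {k} pk with k ≟ x
    ... | yes ≡.refl = μ≈0
    ... | no k≢x     = rel (pk , k≢x)

    rescaled : μ ≉ 0# → CoordinateSpan P W v x
    rescaled μ≉0 = (λ i → t * cs i) , vanishes , hits
      where
      μ⁻¹ = proj₁ (inverse μ μ≉0)
      t = v x * μ⁻¹

      vanishes : ∀ {k} → P k → k ≢ x → ((λ i → t * cs i) · W) k ≈ 0#
      vanishes {k} pk k≢x = begin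
        ((λ i → t * cs i) · W) k ≈⟨ ·-scaleˡ t cs W k ⟩
        t * (cs · W) k           ≈⟨ *-congˡ (rel (pk , k≢x)) ⟩
        t * 0#                   ≈⟨ zeroʳ t ⟩
        0#                       ∎

      hits : P x → ((λ i → t * cs i) · W) x ≈ v x
      hits _ = begin
        ((λ i → t * cs i) · W) x ≈⟨ ·-scaleˡ t cs W x ⟩
        v x * μ⁻¹ * μ            ≈⟨ *-assoc (v x) μ⁻¹ μ ⟩
        v x * (μ⁻¹ * μ)          ≈⟨ *-congˡ (*-comm μ⁻¹ μ) ⟩
        v x * (μ * μ⁻¹)          ≈⟨ *-congˡ (proj₂ (inverse μ μ≉0)) ⟩
        v x * 1#                 ≈⟨ *-identityʳ (v x) ⟩
        v x                      ∎

    case : Dec (μ ≈ 0#) → ¬ ¬ (cs j ≈ 0#)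
    case (yes μ≈0) = ind cs (relOnP μ≈0) j
    case (no μ≉0)  = contradiction (rescaled μ≉0) ¬span

  -- If no column were a pivot, every column would admit a coordinate span of
  -- the first row by independentOn-∖, and summing these would express the
  -- first row through the others.
  exchange : ∀ {m n} {P : Pred (Fin n) 0ℓ} {Ws : Fin (suc m) → Vector Carrier n} →
    IndependentOn P Ws →
    ¬ ¬ (Σ[ x ∈ Fin n ] P x × head Ws x ≉ 0# × IndependentOn (P ∖ x) (tail Ws))
  exchange {P = P} {Ws} ind noPivot =
    ¬¬-pull-Fin spans (head-not-spanned {Ws = Ws} ind ∘ span-from-coordinates)
    where
    spanOrPivot : ∀ x → Dec (P x) → Dec (head Ws x ≈ 0#) → ¬ ¬ CoordinateSpan P (tail Ws) (head Ws) x
    spanOrPivot x (no ¬px)  _          = pure (coordinateSpan-zero {W = tail Ws} {v = head Ws} (λ px → contradiction px ¬px))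
    spanOrPivot x _         (yes vx≈0) = pure (coordinateSpan-zero {W = tail Ws} {v = head Ws} (λ _ → vx≈0))
    spanOrPivot x (yes px)  (no vx≉0)  ¬span =
      noPivot (x , px , vx≉0 , independentOn-∖ {v = head Ws} (independentOn-tail {Ws = Ws} ind) ¬span)

    spans : ∀ x → ¬ ¬ CoordinateSpan P (tail Ws) (head Ws) x
    spans x = do
      px? ← ¬¬-excluded-middle
      vx≈0? ← ¬¬-excluded-middle
      spanOrPivot x px? vx≈0?

  Transversal : ∀ {m n} → Pred (Fin n) 0ℓ → (Fin m → Vector Carrier n) → Set ℓ
  Transversal {m} {n} P Ws =
    Σ[ σ ∈ (Fin m → Fin n) ] Injective _≡_ _≡_ σ × (∀ j → P (σ j) × Ws j (σ j) ≉ 0#)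

  transversal-∷ : ∀ {m n} {P : Pred (Fin n) 0ℓ} {Ws : Fin (suc m) → Vector Carrier n} {x} →
    P x → head Ws x ≉ 0# → Transversal (P ∖ x) (tail Ws) → Transversal P Ws
  transversal-∷ {P = P} {Ws} {x} px vx≉0 (σ , σ-injective , σ-pivots) =
    x Vector.∷ σ , injective-∷ (proj₂ ∘ proj₁ ∘ σ-pivots) σ-injective , pivots
    where
    pivots : ∀ j → P ((x Vector.∷ σ) j) × Ws j ((x Vector.∷ σ) j) ≉ 0#
    pivots zero    = px , vx≉0
    pivots (suc j) = proj₁ (proj₁ (σ-pivots j)) , proj₂ (σ-pivots j)

  transversal : ∀ {m n} {P : Pred (Fin n) 0ℓ} {Ws : Fin m → Vector Carrier n} →
    IndependentOn P Ws → ¬ ¬ Transversal P Ws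
  transversal {zero}  _   = pure ((λ ()) , (λ { {()} }) , λ ())
  transversal {suc m} {Ws = Ws} ind = do
    (x , px , vx≉0 , ind′) ← exchange {Ws = Ws} ind
    τ ← transversal ind′
    pure (transversal-∷ {Ws = Ws} px vx≉0 τ)

  scatter : ∀ {n} (R : List (Fin n)) → Vector Carrier (length R) → Vector Carrier n
  scatter []      cs i = 0#
  scatter (r ∷ R) cs i with i ≟ r
  ... | yes _ = cs zero
  ... | no _  = scatter R (cs ∘ suc) i

  scatter-lookup : ∀ {n} {R : List (Fin n)} → Unique R → ∀ cs j → scatter R cs (lookup R j) ≡ cs j
  scatter-lookup {R = r ∷ R} _ cs zero with r ≟ r
  ... | yes _   = ≡.refl
  ... | no r≢r  = contradiction ≡.refl r≢r
  scatter-lookup {R = r ∷ R} (r∉R ∷ u) cs (suc j) with lookup R j ≟ r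
  ... | yes eq  = contradiction (≡.sym eq) (All.lookup r∉R (∈-lookup j))
  ... | no _    = scatter-lookup u (cs ∘ suc) j

  sumOver-lookup : ∀ {n} (R : List (Fin n)) f → sumOver F R f ≡ sum (f ∘ lookup R)
  sumOver-lookup []      f = ≡.refl
  sumOver-lookup (r ∷ R) f = ≡.cong (f r +_) (sumOver-lookup R f)

  independentRows⇒independentOn : ∀ {n} {A : Matrix F n} {R} →
    IndependentRows F A R → IndependentOn U (A ∘ lookup R)
  independentRows⇒independentOn {A = A} {R} (uniq , ind) cs rel j = pure (begin
    cs j                       ≡⟨ scatter-lookup uniq cs j ⟨
    scatter R cs (lookup R j)  ≈⟨ All.lookup (ind (scatter R cs) scatter-rel) (∈-lookup j) ⟩
    0#                         ∎)
    where
    scatter-rel : ∀ k → sumOver F R (λ i → scatter R cs i * A i k) ≈ 0#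
    scatter-rel k = begin
      sumOver F R (λ i → scatter R cs i * A i k)            ≡⟨ sumOver-lookup R _ ⟩
      sum (λ j → scatter R cs (lookup R j) * A (lookup R j) k)
        ≈⟨ sum-cong-≋ (λ j → *-congʳ (reflexive (scatter-lookup uniq cs j))) ⟩
      (cs · (A ∘ lookup R)) k                               ≈⟨ rel tt ⟩
      0#                                                    ∎

open Nat using (_+_; _*_)

length-filter-split : {P : Pred A p} {Q : Pred A q} (P? : Decidable P) (Q? : Decidable Q) →
  (∀ {x} → ¬ P x → Q x) → ∀ xs → length xs ≤ length (filter P? xs) + length (filter Q? xs)
length-filter-split P? Q? ¬P⇒Q [] = z≤n
length-filter-split P? Q? ¬P⇒Q (x ∷ xs) with ih ← length-filter-split P? Q? ¬P⇒Q xs | P? x | Q? x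
... | yes _ | yes _  = s≤s (≤-trans ih (+-monoʳ-≤ _ (n≤1+n _)))
... | yes _ | no _   = s≤s ih
... | no _  | yes _  = ≤-trans (s≤s ih) (≤-reflexive (≡.sym (+-suc _ _)))
... | no ¬p | no ¬q  = contradiction (¬P⇒Q ¬p) ¬q

Unique⇒length≤∣p∣ : ∀ {n} {p : Subset n} {xs : List (Fin n)} →
  Unique xs → All (Subset._∈ p) xs → length xs ≤ ∣ p ∣
Unique⇒length≤∣p∣ [] [] = z≤n
Unique⇒length≤∣p∣ {p = p} {x ∷ xs} (x≢xs ∷ u) (x∈p ∷ xs∈p) =
  ≤-trans (s≤s (Unique⇒length≤∣p∣ u (All.zipWith xs∈p-x (xs∈p , x≢xs)))) (x∈p⇒∣p-x∣<∣p∣ x∈p)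
  where
  xs∈p-x : ∀ {y} → y Subset.∈ p × x ≢ y → y Subset.∈ p Subset.- x
  xs∈p-x (y∈p , x≢y) = x∈p∧x≢y⇒x∈p-y y∈p (x≢y ∘ ≡.sym)

IsEdge : ∀ {n} → SimpleGraph n → Pred (Fin n × Fin n) 0ℓ
IsEdge G e = Adj G (proj₁ e) (proj₂ e)

NonAttacking : ∀ {n} → Fin n × Fin n → Fin n × Fin n → Set
NonAttacking e f = proj₁ e ≢ proj₁ f × proj₂ e ≢ proj₂ f

nonAttacking-tabulate : ∀ {m n} {ρ σ : Fin m → Fin n} → Injective _≡_ _≡_ ρ → Injective _≡_ _≡_ σ →
  AllPairs NonAttacking (tabulate (λ j → ρ j , σ j))
nonAttacking-tabulate ρ-injective σ-injective =
  AllPairs.tabulate⁺ (λ i≢j → i≢j ∘ ρ-injective , i≢j ∘ σ-injective)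

All-endpoints : ∀ {n} {Q : Pred (Fin n) p} {M} →
  All (λ e → Q (proj₁ e) × Q (proj₂ e)) M → All Q (endpoints M)
All-endpoints []               = []
All-endpoints ((qa , qb) ∷ qs) = qa ∷ qb ∷ All-endpoints qs

endpoints-unique : ∀ {n} {Q : Pred (Fin n) p} {M} → AllPairs NonAttacking M →
  All (λ e → Q (proj₁ e) × ¬ Q (proj₂ e)) M → Unique (endpoints M)
endpoints-unique []          []                 = []
endpoints-unique {Q = Q} {(a , b) ∷ M} (na ∷ nas) ((qa , ¬qb) ∷ sides) =
  (separated qa ¬qb ∷ All-endpoints (All.zipWith fromFirst (na , sides)))
  ∷ All-endpoints (All.zipWith fromSecond (na , sides))
  ∷ endpoints-unique nas sides
  where
  separated : ∀ {x y} → Q x → ¬ Q y → x ≢ y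
  separated qx ¬qy ≡.refl = ¬qy qx

  fromFirst : ∀ {f} → NonAttacking (a , b) f × Q (proj₁ f) × ¬ Q (proj₂ f) → a ≢ proj₁ f × a ≢ proj₂ f
  fromFirst ((a≢c , _) , (_ , ¬qd)) = a≢c , separated qa ¬qd

  fromSecond : ∀ {f} → NonAttacking (a , b) f × Q (proj₁ f) × ¬ Q (proj₂ f) → b ≢ proj₁ f × b ≢ proj₂ f
  fromSecond ((_ , b≢d) , (qc , _)) = separated qc ¬qb ∘ ≡.sym , b≢d

module _ {n} (G : SimpleGraph n) (S : Subset n) (col : Fin n → Bool)
         (proper : ∀ i j → i ∉ S → j ∉ S → Adj G i j → col i ≢ col j) where

  Coloured : Bool → Pred (Fin n) 0ℓ
  Coloured b v = v ∉ S × col v ≡ b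

  colourClass-isMatching : ∀ b {M} → All (IsEdge G) M → AllPairs NonAttacking M →
    All (Coloured b ∘ proj₁) M → IsMatching G M
  colourClass-isMatching b edges nonAttacking coloured =
    edges , endpoints-unique nonAttacking (All.zipWith oneSided (edges , coloured))
    where
    oneSided : ∀ {e} → IsEdge G e × Coloured b (proj₁ e) → Coloured b (proj₁ e) × ¬ Coloured b (proj₂ e)
    oneSided (adj , (i∉S , ci≡b)) =
      (i∉S , ci≡b) , λ (j∉S , cj≡b) → proper _ _ i∉S j∉S adj (≡.trans ci≡b (≡.sym cj≡b))

  rooks-bound : ∀ {m} → (∀ M → IsMatching G M → length M ≤ m) →
    ∀ {T} → All (IsEdge G) T → AllPairs NonAttacking T → length T ≤ 2 * m + ∣ S ∣
  rooks-bound {m} maximal {T} edges nonAttacking = begin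
    length T
      ≤⟨ length-filter-split inS? outS? id T ⟩
    length (filter inS? T) + length Outside
      ≤⟨ +-mono-≤ insideBound (length-filter-split (colour? false) (colour? true) ¬-not Outside) ⟩
    ∣ S ∣ + (length (Class false) + length (Class true))
      ≤⟨ +-monoʳ-≤ ∣ S ∣ (+-mono-≤ (classBound false) (classBound true)) ⟩
    ∣ S ∣ + (m + m)
      ≡⟨ ℕₚ.+-comm ∣ S ∣ (m + m) ⟩
    m + m + ∣ S ∣
      ≡⟨ ≡.cong (λ k → m + k + ∣ S ∣) (ℕₚ.+-identityʳ m) ⟨
    2 * m + ∣ S ∣
      ∎
    where
    open ≤-Reasoning

    inS? : Decidable (λ (e : Fin n × Fin n) → proj₁ e Subset.∈ S)
    inS? e = proj₁ e ∈? S

    outS? : Decidable (λ (e : Fin n × Fin n) → proj₁ e ∉ S)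
    outS? = ¬? ∘ inS?

    colour? : ∀ b → Decidable (λ (e : Fin n × Fin n) → col (proj₁ e) ≡ b)
    colour? b e = col (proj₁ e) ≟ᵇ b

    Outside : List (Fin n × Fin n)
    Outside = filter outS? T

    Class : Bool → List (Fin n × Fin n)
    Class b = filter (colour? b) Outside

    insideBound : length (filter inS? T) ≤ ∣ S ∣
    insideBound = ≤-trans (≤-reflexive (≡.sym (length-map proj₁ (filter inS? T))))
      (Unique⇒length≤∣p∣ (AllPairs.map⁺ (AllPairs.map proj₁ (AllPairs.filter⁺ inS? nonAttacking)))
                          (All.map⁺ (all-filter inS? T)))

    classBound : ∀ b → length (Class b) ≤ m
    classBound b = maximal (Class b) (colourClass-isMatching b
      (All.filter⁺ (colour? b) (All.filter⁺ outS? edges))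
      (AllPairs.filter⁺ (colour? b) (AllPairs.filter⁺ outS? nonAttacking))
      (All.zip (All.filter⁺ (colour? b) (all-filter outS? T) , all-filter (colour? b) Outside)))

lemma6p1 : ∀ {c ℓ} (F : Field c ℓ) (n : ℕ) (G : SimpleGraph n) (A : Matrix F n) →
    (∀ i j → ¬ Adj G i j → Field._≈_ F (A i j) (Field.0# F)) →
    (S : Subset n) → ProperSubset S → BipartiteMinus G S →
    (r m : ℕ) → IsRank F A r → IsMatchingNumber G m →
    r ≤ 2 * m + ∣ S ∣
lemma6p1 F n G A support S _ (col , proper) r m ((R , independent , ≡.refl) , _) (_ , maximal) =
  decidable-stable (r ≤? 2 * m + ∣ S ∣) (do
    (σ , σ-injective , pivots) ← transversal (independentRows⇒independentOn independent)
    edges ← ¬¬-pull-Fin (λ j ¬edge → proj₂ (pivots j) (support _ _ ¬edge))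
    let T = tabulate (λ j → lookup R j , σ j)
    pure (≤-trans (≤-reflexive (≡.sym (length-tabulate _)))
      (rooks-bound G S col proper maximal {T} (All.tabulate⁺ edges)
        (nonAttacking-tabulate (lookup-injective (proj₁ independent)) σ-injective))))
  where open LinearAlgebra F
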